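{- In the persistently evolutionary computation environment $E_e$ (described in the context), for every recursively enumerable language $L\subseteq\Sigma^*$ there exists a syntax-procedure $M\in\Xi_e$ such that $L(M)=L$ (at every stage of the interaction, i.e. whatever the history of previous queries to the successful box).
   Context: Let $\Sigma=\{0,1\}$, $\Gamma=\Sigma\cup\{\triangle\}$ ($\triangle$ blank), $Q_T=\{h\}\cup\{q_i\mid i\ge0\}$. $INST_e=\{[(q,a)\rightarrow(p,b,D)]\mid p,q\in Q_T,a,b\in\Gamma,D\in\{R,L\}\}$; $CONF_e=\{(q,x\underline{a}z)\mid q\in Q_T,x,z\in\Gamma^*,a\in\Gamma\}$ (underline marks the head); $C_{0,x}=(q_0,\underline{\triangle}x)$. $TBOX_e(C,\iota)$: for $C=(q,xb_1\underline{a}b_2y)$, $[(q,a)\rightarrow(p,c,R)]$ yields $(p,xb_1c\underline{b_2}y)$, $[(q,a)\rightarrow(p,c,L)]$ yields $(p,x\underline{b_1}cb_2y)$, all other cases give $\bot$. A syntax-procedure is a finite $M\subseteq INST_e$ with at most one $\iota\in M$ such that $TBOX_e(C,\iota)\neq\bot$ for each $C$; $\Xi_e$ is their set; $\upsilon(M,(q,x\underline{a}y))$ is the instruction of $M$ with left side $(q,a)$ if any, else $\bot$. The successful box $SBOX_e$ is history-dependent: $SBOX_e(h,\underline{\triangle}x)=YES$; on $C=(h,x\underline{\triangle})$ it feeds $x$ to the persistently evolutionary machine $PT_1$ in its current state and answers $YES$ iff $PT_1$ outputs $1$ (after which $PT_1$ evolves); on all other configurations it answers $NO$. Here $PT_1$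 maintains an automaton $M_{cur}$ (partial deterministic transitions over $\{0,1\}$, accepting set $F$), initially one state $q_0$, no transitions, $F=\emptyset$; on input $x=a_0\cdots a_k$ it replaces $M_{cur}$ by $h(M_{cur},x)$ and outputs $1$ iff $h(M_{cur},x)$ accepts $x$, where $h(M,x)$ is: $M$ if $M$ reads all of $x$ and ends accepting; if $M$ ends in non-accepting $p$, then $M$ if some single letter leads from $p$ to an accepting state, otherwise $M$ with $p$ added to $F$; if $M$ crashes after $a_0\cdots a_i$ in state $q$, then $M$ extended by new states $s_{i+1},\dots,s_k$, transitions $q\xrightarrow{a_{i+1}}s_{i+1}\xrightarrow{a_{i+2}}\cdots\xrightarrow{a_k}s_k$, with $s_k$ added to $F$. $x\in L(M)$ iff there is a sequence $C_0=C_{0,x},C_1,\dots,C_n$ with $C_i=TBOX_e(C_{i-1},\upsilon(M,C_{i-1}))$, $SBOX_e(C_n)=YES$, and $\upsilon(M,C_n)=\bot$ or $TBOX_e(C_n,\upsilon(M,C_n))=\bot$. -}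

module Defs where

open import Data.Nat using (ℕ; zero; suc)
open import Data.Nat.Properties using () renaming (_≟_ to _≟ℕ_)
open import Data.Bool using (Bool; true; false; if_then_else_; _∨_)
open import Data.List using (List; []; _∷_; map; reverse; foldl)
open import Data.Maybe using (Maybe; just; nothing; _>>=_)
open import Data.Product using (Σ; ∃; _×_; _,_)
open import Data.Sum using (_⊎_)
open import Data.List.Membership.Propositional using (_∈_)
open import Relation.Binary.PropositionalEquality using (_≡_; _≢_; refl)
open import Relation.Nullary using (Dec; yes; no)
open import Relation.Nullary.Decidable using (⌊_⌋)

data Bit : Set where
  𝟎 𝟏 : Bit

data Sym : Set where
  ⟨_⟩ : Bit → Sym
  △   : Sym

data State : Set where
  h : State
  q : ℕ → State

data Dir : Set where
  R L : Dir

record Inst : Set where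
  constructor [_,_⇒_,_,_]
  field
    from  : State
    read  : Sym
    to    : State
    write : Sym
    dir   : Dir
open Inst public

-- configuration (q , x a z): the part left of the head is stored
-- REVERSED (leftRev = reverse x), so that its last letter is at hand.
record Conf : Set where
  constructor conf
  field
    state   : State
    leftRev : List Sym
    head    : Sym
    right   : List Sym
open Conf public

_≟B_ : (a b : Bit) → Dec (a ≡ b)
𝟎 ≟B 𝟎 = yes refl
𝟎 ≟B 𝟏 = no λ ()
𝟏 ≟B 𝟎 = no λ ()
𝟏 ≟B 𝟏 = yes refl

_≟S_ : (a b : Sym) → Dec (a ≡ b)
⟨ a ⟩ ≟S ⟨ b ⟩ with a ≟B b
... | yes refl = yes refl
... | no ne = no λ { refl → ne refl }
⟨ _ ⟩ ≟S △ = no λ ()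
△ ≟S ⟨ _ ⟩ = no λ ()
△ ≟S △ = yes refl

_≟Q_ : (a b : State) → Dec (a ≡ b)
h ≟Q h = yes refl
h ≟Q q _ = no λ ()
q _ ≟Q h = no λ ()
q m ≟Q q n with m ≟ℕ n
... | yes refl = yes refl
... | no ne = no λ { refl → ne refl }

C₀ : List Bit → Conf
C₀ x = conf (q 0) [] △ (map ⟨_⟩ x)

-- the transition box TBOX_e (nothing = ⊥).  Moving right off the right
-- end of the written tape scans a fresh blank; moving left off the left
-- end is ⊥.
TBOX : Conf → Inst → Maybe Conf
TBOX (conf s lr a rt) ι with ⌊ s ≟Q from ι ⌋ | ⌊ a ≟S read ι ⌋
TBOX (conf s lr a rt) ι | true | true with dir ι | rt | lr
... | R | []      | _       = just (conf (to ι) (write ι ∷ lr) △ [])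
... | R | b ∷ y   | _       = just (conf (to ι) (write ι ∷ lr) b y)
... | L | _       | []      = nothing
... | L | _       | b ∷ x   = just (conf (to ι) x b (write ι ∷ rt))
TBOX _ _ | _ | _ = nothing

SyntaxProc : List Inst → Set
SyntaxProc M = ∀ (C : Conf) (ι ι′ : Inst) → ι ∈ M → ι′ ∈ M →
  TBOX C ι ≢ nothing → TBOX C ι′ ≢ nothing → ι ≡ ι′

υ : List Inst → Conf → Maybe Inst
υ [] C = nothing
υ (ι ∷ M) C with ⌊ state C ≟Q from ι ⌋ | ⌊ head C ≟S read ι ⌋
... | true | true = just ι
... | _    | _    = υ M C

step : List Inst → Conf → Maybe Conf
step M C = υ M C >>= TBOX C

steps : List Inst → ℕ → Conf → Maybe Conf
steps M zero C = just C
steps M (suc n) C = step M C >>= steps M n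

Terminal : List Inst → Conf → Set
Terminal M C = (υ M C ≡ nothing) ⊎ (∃ λ ι → υ M C ≡ just ι × TBOX C ι ≡ nothing)

-- automaton: states are 0 … next-1, initial state 0,
-- partial deterministic transitions δ, accepting set acc
record Aut : Set where
  constructor aut
  field
    next : ℕ
    δ    : ℕ → Bit → Maybe ℕ
    acc  : ℕ → Bool
open Aut public

initAut : Aut
initAut = aut 1 (λ _ _ → nothing) (λ _ → false)

data RunRes : Set where
  ends  : ℕ → RunRes
  crash : ℕ → Bit → List Bit → RunRes     -- stuck in state q on letter a, rest unread

runFrom : (ℕ → Bit → Maybe ℕ) → ℕ → List Bit → RunRes
runFrom δ p [] = ends p
runFrom δ p (a ∷ x) with δ p a
... | just p′ = runFrom δ p′ x
... | nothing = crash p a x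

accepts : Aut → List Bit → Bool
accepts A x with runFrom (δ A) 0 x
... | ends p = acc A p
... | crash _ _ _ = false

updδ : (ℕ → Bit → Maybe ℕ) → ℕ → Bit → ℕ → (ℕ → Bit → Maybe ℕ)
updδ d p a r p′ a′ = if ⌊ p ≟ℕ p′ ⌋ then (if ⌊ a ≟B a′ ⌋ then just r else d p′ a′) else d p′ a′

addAcc : (ℕ → Bool) → ℕ → (ℕ → Bool)
addAcc f p p′ = ⌊ p ≟ℕ p′ ⌋ ∨ f p′

addChain : Aut → ℕ → Bit → List Bit → Aut
addChain (aut n d f) p a [] = aut (suc n) (updδ d p a n) (addAcc f n)
addChain (aut n d f) p a (b ∷ bs) = addChain (aut (suc n) (updδ d p a n) f) n b bs

isJustAcc : (ℕ → Bool) → Maybe ℕ → Bool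
isJustAcc f (just r) = f r
isJustAcc f nothing = false

hUpd : Aut → List Bit → Aut
hUpd A x with runFrom (δ A) 0 x
... | crash p a rest = addChain A p a rest
... | ends p with acc A p
...   | true = A
...   | false with isJustAcc (acc A) (δ A p 𝟎) ∨ isJustAcc (acc A) (δ A p 𝟏)
...     | true = A
...     | false = aut (next A) (δ A) (addAcc (acc A) p)

PT₁out : Aut → List Bit → Bool
PT₁out A x = accepts (hUpd A x) x

stateAfter : List (List Bit) → Aut
stateAfter hs = foldl hUpd initAut hs

toBits : List Sym → Maybe (List Bit)
toBits [] = just []
toBits (⟨ b ⟩ ∷ s) with toBits s
... | just w = just (b ∷ w)
... | nothing = nothing
toBits (△ ∷ s) = nothing

SBOX : Aut → Conf → Bool
SBOX A (conf h [] △ rt) = true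
SBOX A (conf h lr@(_ ∷ _) △ []) with toBits (reverse lr)
... | just x  = PT₁out A x
... | nothing = false
SBOX A _ = false

Accepts : Aut → List Inst → List Bit → Set
Accepts A M x = ∃ λ n → ∃ λ C →
  steps M n (C₀ x) ≡ just C × SBOX A C ≡ true × Terminal M C

HaltsH : List Inst → List Bit → Set
HaltsH T x = ∃ λ n → ∃ λ C →
  steps T n (C₀ x) ≡ just C × state C ≡ h × step T C ≡ nothing

RE : (List Bit → Set) → Set
RE Lang = Σ (List Inst) λ T → SyntaxProc T × (∀ x → Lang x → HaltsH T x) × (∀ x → HaltsH T x → Lang x)

-- The successful box answers YES independently of PT₁'s state on exactly
-- one kind of configuration, (h, △̲ x): state h with the head on the
-- leftmost cell.  Given a machine T that semidecides L by halting in h, we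
-- build a simulator M that only ever stops in such a configuration when T
-- halts in h, and otherwise stops (if at all) in a state q j, where the box
-- says NO.  M first shifts the input one cell to the right, so that a blank
-- sentinel sits left of T's tape; it then simulates T step by step.  Every
-- left move is followed by a probe (left and back) which gets stuck exactly
-- on the sentinel.  For T's own state h the probe is made in state h
-- itself, so falling off the tape in h is an accepting stop; when T halts
-- in h, M sweeps left in state h until it stops on the sentinel, writing a
-- symbol on which T has no h-instruction into every cell it leaves, so that
-- returning from each probe it can tell the sweep from a simulated move.
module Submission where

open import Defs
open import Data.List using (List; []; _∷_; _++_; map; concatMap; cartesianProduct; _ʳ++_; drop)
open import Data.List.Membership.Propositional using (_∈_; lose)
open import Data.List.Membership.Propositional.Properties
  using (∈-++⁺ˡ; ∈-++⁺ʳ; ∈-map⁺; ∈-concatMap⁺; ∈-concatMap⁻; ∈-cartesianProduct⁺)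
open import Data.List.Relation.Unary.Any using (here; there; satisfied)
open import Data.Product using (Σ; ∃; ∃₂; _×_; _,_; proj₁; proj₂)
open import Data.Nat using (ℕ; zero; suc; _+_; _≤_; z≤n; s≤s)
open import Data.Nat.Properties using (≤-trans; m≤n+m; <⇒≱)
open import Data.Maybe using (Maybe; just; nothing; _>>=_)
open import Data.Maybe.Properties using (just-injective)
open import Data.Bool using (true; false)
open import Data.Sum using (inj₁; inj₂)
open import Data.Empty using (⊥; ⊥-elim)
open import Relation.Binary.PropositionalEquality
open import Relation.Nullary using (yes; no)
open import Relation.Nullary.Decidable using (⌊_⌋; isYes≗does; dec-true)

≟Q-refl : ∀ s → ⌊ s ≟Q s ⌋ ≡ true
≟Q-refl s = trans (isYes≗does (s ≟Q s)) (dec-true (s ≟Q s) refl)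

≟S-refl : ∀ a → ⌊ a ≟S a ⌋ ≡ true
≟S-refl a = trans (isYes≗does (a ≟S a)) (dec-true (a ≟S a) refl)

move : Dir → State → Sym → List Sym → List Sym → Maybe Conf
move R p b lr [] = just (conf p (b ∷ lr) △ [])
move R p b lr (c ∷ y) = just (conf p (b ∷ lr) c y)
move L p b [] rt = nothing
move L p b (c ∷ x) rt = just (conf p x c (b ∷ rt))

scan : List Sym → Sym
scan [] = △
scan (c ∷ _) = c

move-R : ∀ p b lr rt → move R p b lr rt ≡ just (conf p (b ∷ lr) (scan rt) (drop 1 rt))
move-R p b lr [] = refl
move-R p b lr (c ∷ rt) = refl

TBOX-applicable : ∀ s lr a rt p b d →
  TBOX (conf s lr a rt) [ s , a ⇒ p , b , d ] ≡ move d p b lr rt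
TBOX-applicable s lr a [] p b R rewrite ≟Q-refl s | ≟S-refl a = refl
TBOX-applicable s lr a (c ∷ rt) p b R rewrite ≟Q-refl s | ≟S-refl a = refl
TBOX-applicable s [] a rt p b L rewrite ≟Q-refl s | ≟S-refl a = refl
TBOX-applicable s (c ∷ lr) a rt p b L rewrite ≟Q-refl s | ≟S-refl a = refl

TBOX-matches : ∀ C ι → TBOX C ι ≢ nothing → (state C ≡ from ι) × (head C ≡ read ι)
TBOX-matches (conf s lr a rt) ι fires with s ≟Q from ι | a ≟S read ι
... | yes s≡ | yes a≡ = s≡ , a≡
... | yes _ | no _ = ⊥-elim (fires refl)
... | no _ | _ = ⊥-elim (fires refl)

υ-sound : ∀ N C ι → υ N C ≡ just ι → (ι ∈ N) × (state C ≡ from ι) × (head C ≡ read ι)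
υ-sound (ι′ ∷ N) C ι found with state C ≟Q from ι′ | head C ≟S read ι′
... | yes s≡ | yes a≡ with just-injective found
...   | refl = here refl , s≡ , a≡
υ-sound (ι′ ∷ N) C ι found | yes _ | no _ with υ-sound N C ι found
...   | ι∈ , s≡ , a≡ = there ι∈ , s≡ , a≡
υ-sound (ι′ ∷ N) C ι found | no _ | _ with υ-sound N C ι found
...   | ι∈ , s≡ , a≡ = there ι∈ , s≡ , a≡

υ-complete : ∀ N C ι → ι ∈ N → state C ≡ from ι → head C ≡ read ι → ∃ λ ι′ → υ N C ≡ just ι′
υ-complete (ι′ ∷ N) C ι ι∈ s≡ a≡ with state C ≟Q from ι′ | head C ≟S read ι′
... | yes _ | yes _ = ι′ , refl
... | yes _ | no a≢ with ι∈
...   | here refl = ⊥-elim (a≢ a≡)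
...   | there ι∈N = υ-complete N C ι ι∈N s≡ a≡
υ-complete (ι′ ∷ N) C ι ι∈ s≡ a≡ | no s≢ | _ with ι∈
...   | here refl = ⊥-elim (s≢ s≡)
...   | there ι∈N = υ-complete N C ι ι∈N s≡ a≡

υ-local : ∀ N s lr a rt → υ N (conf s lr a rt) ≡ υ N (conf s [] a [])
υ-local [] s lr a rt = refl
υ-local (ι ∷ N) s lr a rt with ⌊ s ≟Q from ι ⌋ | ⌊ a ≟S read ι ⌋
... | true | true = refl
... | true | false = υ-local N s lr a rt
... | false | _ = υ-local N s lr a rt

module Runs (N : List Inst) where

  instrOf : State → Sym → Maybe Inst
  instrOf s a = υ N (conf s [] a [])

  data InstrView (s : State) (a : Sym) : Set where
    idle  : instrOf s a ≡ nothing → InstrView s a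
    fires : ∀ p b d → [ s , a ⇒ p , b , d ] ∈ N →
            instrOf s a ≡ just [ s , a ⇒ p , b , d ] → InstrView s a

  instrView : ∀ s a → InstrView s a
  instrView s a with instrOf s a in found
  ... | nothing = idle found
  ... | just [ f , r ⇒ p , b , d ] with υ-sound N _ _ found
  ...   | ι∈ , refl , refl = fires p b d ι∈ found

  step-local : ∀ s lr a rt → step N (conf s lr a rt) ≡ (instrOf s a >>= TBOX (conf s lr a rt))
  step-local s lr a rt = cong (_>>= TBOX (conf s lr a rt)) (υ-local N s lr a rt)

  step-fires : ∀ {s a p b d} lr rt → instrOf s a ≡ just [ s , a ⇒ p , b , d ] →
    step N (conf s lr a rt) ≡ move d p b lr rt
  step-fires {s} {a} {p} {b} {d} lr rt found = begin
    step N (conf s lr a rt)                      ≡⟨ step-local s lr a rt ⟩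
    (instrOf s a >>= TBOX (conf s lr a rt))      ≡⟨ cong (_>>= TBOX (conf s lr a rt)) found ⟩
    TBOX (conf s lr a rt) [ s , a ⇒ p , b , d ]  ≡⟨ TBOX-applicable s lr a rt p b d ⟩
    move d p b lr rt                             ∎
    where open ≡-Reasoning

  step-idle : ∀ {s a} lr rt → instrOf s a ≡ nothing → step N (conf s lr a rt) ≡ nothing
  step-idle {s} {a} lr rt none = trans (step-local s lr a rt) (cong (_>>= TBOX (conf s lr a rt)) none)

  steps-suc : ∀ {C C₁ C₂} k → step N C ≡ just C₁ → steps N k C₁ ≡ just C₂ → steps N (suc k) C ≡ just C₂
  steps-suc k e e′ rewrite e = e′

  steps-+ : ∀ {C C₁ C₂} a b → steps N a C ≡ just C₁ → steps N b C₁ ≡ just C₂ → steps N (a + b) C ≡ just C₂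
  steps-+ zero b refl e₂ = e₂
  steps-+ {C} (suc a) b e₁ e₂ with step N C
  ... | just C′ = steps-+ a b e₁ e₂

  Reach Reach⁺ : Conf → Conf → Set
  Reach C C′ = ∃ λ k → steps N k C ≡ just C′
  Reach⁺ C C′ = ∃ λ k → steps N (suc k) C ≡ just C′

  stop : ∀ {C} → Reach C C
  stop = 0 , refl

  _▸⁺_ : ∀ {C C₁ C₂} → step N C ≡ just C₁ → Reach C₁ C₂ → Reach⁺ C C₂
  e ▸⁺ (k , r) = k , steps-suc k e r

  ⁺⇒ : ∀ {C C′} → Reach⁺ C C′ → Reach C C′
  ⁺⇒ (k , r) = suc k , r

  _▸_ : ∀ {C C₁ C₂} → step N C ≡ just C₁ → Reach C₁ C₂ → Reach C C₂
  e ▸ r = ⁺⇒ (e ▸⁺ r)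

  _⨾_ : ∀ {C₁ C₂ C₃} → Reach C₁ C₂ → Reach C₂ C₃ → Reach C₁ C₃
  (k₁ , r₁) ⨾ (k₂ , r₂) = k₁ + k₂ , steps-+ k₁ k₂ r₁ r₂

  infixr 4 _▸⁺_ _▸_
  infixr 3 _⨾_

  halted-bound : ∀ {C C₁ C₂} n k → steps N n C ≡ just C₁ → step N C₁ ≡ nothing →
    steps N k C ≡ just C₂ → k ≤ n
  halted-bound n zero _ _ _ = z≤n
  halted-bound zero (suc k) refl stuck r rewrite stuck with r
  ... | ()
  halted-bound {C} (suc n) (suc k) r₁ stuck r₂ with step N C
  ... | just C′ = s≤s (halted-bound n k r₁ stuck r₂)

  halted-unique : ∀ {C C₁ C₂} n m → steps N n C ≡ just C₁ → step N C₁ ≡ nothing →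
    steps N m C ≡ just C₂ → step N C₂ ≡ nothing → C₁ ≡ C₂
  halted-unique zero zero r₁ _ r₂ _ = just-injective (trans (sym r₁) r₂)
  halted-unique zero (suc m) refl stuck₁ r₂ _ rewrite stuck₁ with r₂
  ... | ()
  halted-unique (suc n) zero r₁ _ refl stuck₂ rewrite stuck₂ with r₁
  ... | ()
  halted-unique {C} (suc n) (suc m) r₁ stuck₁ r₂ stuck₂ with step N C
  ... | just C′ = halted-unique n m r₁ stuck₁ r₂ stuck₂

  Terminal⇒stuck : ∀ {C} → Terminal N C → step N C ≡ nothing
  Terminal⇒stuck {C} (inj₁ none) rewrite none = refl
  Terminal⇒stuck {C} (inj₂ (ι , found , blocked)) rewrite found = blocked

allSyms : List Sym
allSyms = △ ∷ ⟨ 𝟎 ⟩ ∷ ⟨ 𝟏 ⟩ ∷ []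

allSyms-complete : ∀ a → a ∈ allSyms
allSyms-complete △ = here refl
allSyms-complete ⟨ 𝟎 ⟩ = there (here refl)
allSyms-complete ⟨ 𝟏 ⟩ = there (there (here refl))

module Table {S : Set} (enc : S → State) (enc-inj : ∀ {m m′} → enc m ≡ enc m′ → m ≡ m′)
             (table : S → Sym → Maybe (S × Sym × Dir)) (states : List S) where

  inst : S → Sym → S × Sym × Dir → Inst
  inst m a (p , b , d) = [ enc m , a ⇒ enc p , b , d ]

  entries : S → Sym → Maybe (S × Sym × Dir) → List Inst
  entries m a nothing = []
  entries m a (just r) = inst m a r ∷ []

  row : S × Sym → List Inst
  row (m , a) = entries m a (table m a)

  -- Opaque: it is only ever used through the lemmas below, and unfolding
  -- a concrete table would make type checking slow.
  opaque
    machine : List Inst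
    machine = concatMap row (cartesianProduct states allSyms)

  Entry : Inst → Set
  Entry ι = ∃₂ λ m a → ∃ λ r → table m a ≡ just r × ι ≡ inst m a r

  entries⁻ : ∀ {ι} m a mr → ι ∈ entries m a mr → ∃ λ r → mr ≡ just r × ι ≡ inst m a r
  entries⁻ m a (just r) (here refl) = r , refl , refl

  opaque
    unfolding machine

    entry⁻ : ∀ {ι} → ι ∈ machine → Entry ι
    entry⁻ ι∈ with satisfied (∈-concatMap⁻ row {cartesianProduct states allSyms} ι∈)
    ... | (m , a) , ι∈row with entries⁻ m a (table m a) ι∈row
    ...   | r , t , ι≡ = m , a , r , t , ι≡

    entry⁺ : ∀ {m a r} → m ∈ states → table m a ≡ just r → inst m a r ∈ machine
    entry⁺ {m} {a} m∈ t = ∈-concatMap⁺ row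
      (lose (∈-cartesianProduct⁺ m∈ (allSyms-complete a))
            (subst (λ mr → _ ∈ entries m a mr) (sym t) (here refl)))

  same-entry : ∀ {m₁ m₂ a₁ a₂ r₁ r₂} → enc m₁ ≡ enc m₂ → a₁ ≡ a₂ →
    table m₁ a₁ ≡ just r₁ → table m₂ a₂ ≡ just r₂ → inst m₁ a₁ r₁ ≡ inst m₂ a₂ r₂
  same-entry e refl t₁ t₂ with enc-inj e
  ... | refl with trans (sym t₁) t₂
  ...   | refl = refl

  machine-syntaxProc : SyntaxProc machine
  machine-syntaxProc C ι ι′ ι∈ ι′∈ fires fires′
    with TBOX-matches C ι fires | TBOX-matches C ι′ fires′ | entry⁻ ι∈ | entry⁻ ι′∈
  ... | s≡ , a≡ | s≡′ , a≡′ | _ , _ , _ , t , refl | _ , _ , _ , t′ , refl =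
    same-entry (trans (sym s≡) s≡′) (trans (sym a≡) a≡′) t t′

  machine-υ : ∀ {m a r} lr rt → m ∈ states → table m a ≡ just r →
    υ machine (conf (enc m) lr a rt) ≡ just (inst m a r)
  machine-υ lr rt m∈ t with υ-complete machine (conf _ lr _ rt) _ (entry⁺ m∈ t) refl refl
  ... | ι , found with υ-sound machine _ ι found
  ...   | ι∈ , s≡ , a≡ with entry⁻ ι∈
  ...     | _ , _ , _ , t′ , refl = trans found (cong just (sym (same-entry s≡ a≡ t t′)))

  machine-υ-none : ∀ {m a} lr rt → table m a ≡ nothing → υ machine (conf (enc m) lr a rt) ≡ nothing
  machine-υ-none {m} {a} lr rt none with υ machine (conf (enc m) lr a rt) in found
  ... | nothing = refl
  ... | just ι with υ-sound machine _ ι found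
  ...   | ι∈ , s≡ , refl with entry⁻ ι∈
  ...     | m′ , _ , _ , t , refl with enc-inj {m} {m′} s≡
  ...       | refl with trans (sym none) t
  ...         | ()

  machine-step : ∀ {m a p b d} lr rt → m ∈ states → table m a ≡ just (p , b , d) →
    step machine (conf (enc m) lr a rt) ≡ move d (enc p) b lr rt
  machine-step {m} {a} {p} {b} {d} lr rt m∈ t
    rewrite machine-υ lr rt m∈ t = TBOX-applicable (enc m) lr a rt (enc p) b d

  machine-stuck : ∀ {m a} lr rt → table m a ≡ nothing → step machine (conf (enc m) lr a rt) ≡ nothing
  machine-stuck lr rt none rewrite machine-υ-none lr rt none = refl

-- Control states: `halt` is h itself and probes one cell to the left
-- (it is stuck exactly on the leftmost cell); `haltBack`, `haltFwd` and
-- `resume` return from that probe and decide how to continue; `sweep`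
-- walks left after T has halted; `start`, `carry c` and `rewind` shift
-- the input right, and `launch` starts the simulation.
data Ctl : Set where
  halt start rewind launch haltBack haltFwd resume sweep : Ctl
  carry : Sym → Ctl

allCtl : List Ctl
allCtl = halt ∷ start ∷ rewind ∷ launch ∷ haltBack ∷ haltFwd ∷ resume ∷ sweep ∷ map carry allSyms

allCtl-complete : ∀ c → c ∈ allCtl
allCtl-complete halt = here refl
allCtl-complete start = there (here refl)
allCtl-complete rewind = there (there (here refl))
allCtl-complete launch = there (there (there (here refl)))
allCtl-complete haltBack = there (there (there (there (here refl))))
allCtl-complete haltFwd = there (there (there (there (there (here refl)))))
allCtl-complete resume = there (there (there (there (there (there (here refl))))))
allCtl-complete sweep = there (there (there (there (there (there (there (here refl)))))))
allCtl-complete (carry a) =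
  there (there (there (there (there (there (there (there (∈-map⁺ carry (allSyms-complete a)))))))))

-- `sim s` simulates T in state s; `probeL s`, `probeR s` check, after a
-- simulated left move into s, that the head did not reach the sentinel.
data MState : Set where
  ctl : Ctl → MState
  sim probeL probeR : State → MState

-- The three families indexed by T's states are interleaved above q 9:
-- family k ∈ {0,1,2} at index i is coded by 10 + k + 3 i.
tag : ℕ → ℕ → ℕ
tag k zero = k
tag k (suc i) = suc (suc (suc (tag k i)))

untag : ℕ → ℕ × ℕ
untag zero = 0 , 0
untag (suc zero) = 1 , 0
untag (suc (suc zero)) = 2 , 0
untag (suc (suc (suc n))) = proj₁ (untag n) , suc (proj₂ (untag n))

untag-tag : ∀ k i → untag k ≡ (k , 0) → untag (tag k i) ≡ (k , i)
untag-tag k zero base = base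
untag-tag k (suc i) base rewrite untag-tag k i base = refl

idx : State → ℕ
idx h = 0
idx (q i) = suc i

unidx : ℕ → State
unidx zero = h
unidx (suc i) = q i

unidx-idx : ∀ s → unidx (idx s) ≡ s
unidx-idx h = refl
unidx-idx (q i) = refl

enc : MState → State
enc (ctl halt) = h
enc (ctl start) = q 0
enc (ctl (carry △)) = q 1
enc (ctl (carry ⟨ 𝟎 ⟩)) = q 2
enc (ctl (carry ⟨ 𝟏 ⟩)) = q 3
enc (ctl rewind) = q 4
enc (ctl launch) = q 5
enc (ctl haltBack) = q 6
enc (ctl haltFwd) = q 7
enc (ctl resume) = q 8
enc (ctl sweep) = q 9
enc (sim s) = q (10 + tag 0 (idx s))
enc (probeL s) = q (10 + tag 1 (idx s))
enc (probeR s) = q (10 + tag 2 (idx s))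

family : ℕ → State → Maybe MState
family 0 s = just (sim s)
family 1 s = just (probeL s)
family 2 s = just (probeR s)
family _ _ = nothing

dec : State → Maybe MState
dec h = just (ctl halt)
dec (q 0) = just (ctl start)
dec (q 1) = just (ctl (carry △))
dec (q 2) = just (ctl (carry ⟨ 𝟎 ⟩))
dec (q 3) = just (ctl (carry ⟨ 𝟏 ⟩))
dec (q 4) = just (ctl rewind)
dec (q 5) = just (ctl launch)
dec (q 6) = just (ctl haltBack)
dec (q 7) = just (ctl haltFwd)
dec (q 8) = just (ctl resume)
dec (q 9) = just (ctl sweep)
dec (q (suc (suc (suc (suc (suc (suc (suc (suc (suc (suc n)))))))))))
  = family (proj₁ (untag n)) (unidx (proj₂ (untag n)))

dec-enc : ∀ m → dec (enc m) ≡ just m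
dec-enc (ctl halt) = refl
dec-enc (ctl start) = refl
dec-enc (ctl (carry △)) = refl
dec-enc (ctl (carry ⟨ 𝟎 ⟩)) = refl
dec-enc (ctl (carry ⟨ 𝟏 ⟩)) = refl
dec-enc (ctl rewind) = refl
dec-enc (ctl launch) = refl
dec-enc (ctl haltBack) = refl
dec-enc (ctl haltFwd) = refl
dec-enc (ctl resume) = refl
dec-enc (ctl sweep) = refl
dec-enc (sim s) rewrite untag-tag 0 (idx s) refl | unidx-idx s = refl
dec-enc (probeL s) rewrite untag-tag 1 (idx s) refl | unidx-idx s = refl
dec-enc (probeR s) rewrite untag-tag 2 (idx s) refl | unidx-idx s = refl

enc-inj : ∀ {m m′} → enc m ≡ enc m′ → m ≡ m′
enc-inj {m} {m′} e = just-injective (trans (sym (dec-enc m)) (trans (cong dec e) (dec-enc m′)))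

SBOX-rejects-q : ∀ A C j → state C ≡ q j → SBOX A C ≡ true → ⊥
SBOX-rejects-q A (conf .(q j) lr a rt) j refl ()

Act : Set
Act = MState × Sym × Dir

-- A left move is followed by a probe; in state h the probe comes first
-- (T's instruction is executed on return, by `resumeAct`), since h has no
-- room to remember the instruction.
simAct : State → Sym → Maybe Inst → Maybe Act
simAct s a (just [ _ , _ ⇒ p , b , R ]) = just (sim p , b , R)
simAct h a (just [ _ , _ ⇒ _ , _ , L ]) = just (ctl halt , a , L)
simAct (q _) a (just [ _ , _ ⇒ p , b , L ]) = just (probeL p , b , L)
simAct h a nothing = just (ctl halt , a , L)
simAct (q _) a nothing = nothing

-- Back on the cell T scanned in state h: execute T's left move there, or,
-- if T has no instruction (T halted, or the sweep wrote there), sweep on.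
resumeAct : Sym → Maybe Inst → Maybe Act
resumeAct a nothing = just (ctl sweep , a , L)
resumeAct a (just [ _ , _ ⇒ p , b , L ]) = just (sim p , b , L)
resumeAct a (just [ _ , _ ⇒ _ , _ , R ]) = nothing   -- not reachable

pick : Maybe Inst → Maybe Inst → Sym
pick nothing _ = △
pick (just _) nothing = ⟨ 𝟎 ⟩
pick (just _) (just _) = ⟨ 𝟏 ⟩

module Simulator (T : List Inst) where

  module RT = Runs T
  open RT using (instrOf; instrView; idle; fires)

  quiet : Sym
  quiet = pick (instrOf h △) (instrOf h ⟨ 𝟎 ⟩)

  quiet-idle : ∀ z → instrOf h z ≡ nothing → instrOf h quiet ≡ nothing
  quiet-idle z none with instrOf h △ in e△ | instrOf h ⟨ 𝟎 ⟩ in e𝟎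
  ... | nothing | _ = e△
  ... | just _ | nothing = e𝟎
  quiet-idle △ none | just _ | just _ with trans (sym e△) none
  ... | ()
  quiet-idle ⟨ 𝟎 ⟩ none | just _ | just _ with trans (sym e𝟎) none
  ... | ()
  quiet-idle ⟨ 𝟏 ⟩ none | just _ | just _ = none

  Δ : MState → Sym → Maybe Act
  Δ (ctl start) △ = just (ctl (carry △) , △ , R)
  Δ (ctl start) ⟨ _ ⟩ = nothing
  Δ (ctl (carry c)) ⟨ y ⟩ = just (ctl (carry ⟨ y ⟩) , c , R)
  Δ (ctl (carry △)) △ = just (ctl launch , △ , L)
  Δ (ctl (carry ⟨ y ⟩)) △ = just (ctl rewind , ⟨ y ⟩ , L)
  Δ (ctl rewind) ⟨ y ⟩ = just (ctl rewind , ⟨ y ⟩ , L)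
  Δ (ctl rewind) △ = just (ctl launch , △ , L)
  Δ (ctl launch) a = just (sim (q 0) , a , R)
  Δ (ctl halt) a = just (ctl haltBack , a , L)
  Δ (ctl haltBack) a = just (ctl haltFwd , a , R)
  Δ (ctl haltFwd) a = just (ctl resume , a , R)
  Δ (ctl resume) a = resumeAct a (instrOf h a)
  Δ (ctl sweep) a = just (ctl halt , quiet , L)
  Δ (sim s) a = simAct s a (instrOf s a)
  Δ (probeL p) a = just (probeR p , a , L)
  Δ (probeR p) a = just (sim p , a , R)

  Tstates : List State
  Tstates = h ∷ q 0 ∷ map to T

  states : List MState
  states = map ctl allCtl ++ map sim Tstates ++ map probeL Tstates ++ map probeR Tstates

  ctl∈ : ∀ c → ctl c ∈ states
  ctl∈ c = ∈-++⁺ˡ (∈-map⁺ ctl (allCtl-complete c))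

  sim∈ : ∀ {s} → s ∈ Tstates → sim s ∈ states
  sim∈ s∈ = ∈-++⁺ʳ (map ctl allCtl) (∈-++⁺ˡ (∈-map⁺ sim s∈))

  probeL∈ : ∀ {s} → s ∈ Tstates → probeL s ∈ states
  probeL∈ s∈ = ∈-++⁺ʳ (map ctl allCtl) (∈-++⁺ʳ (map sim Tstates) (∈-++⁺ˡ (∈-map⁺ probeL s∈)))

  probeR∈ : ∀ {s} → s ∈ Tstates → probeR s ∈ states
  probeR∈ s∈ = ∈-++⁺ʳ (map ctl allCtl) (∈-++⁺ʳ (map sim Tstates) (∈-++⁺ʳ (map probeL Tstates) (∈-map⁺ probeR s∈)))

  target∈ : ∀ {ι} → ι ∈ T → to ι ∈ Tstates
  target∈ ι∈ = there (there (∈-map⁺ to ι∈))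

  open Table enc enc-inj Δ states

  simulator : List Inst
  simulator = machine

  simulator-syntaxProc : SyntaxProc simulator
  simulator-syntaxProc = machine-syntaxProc

  open Runs simulator
    using (Reach; Reach⁺; stop; _▸⁺_; _▸_; ⁺⇒; _⨾_; steps-+; halted-bound; halted-unique; Terminal⇒stuck)

  fire : ∀ m a lr rt {p b d} → m ∈ states → Δ m a ≡ just (p , b , d) →
    step simulator (conf (enc m) lr a rt) ≡ move d (enc p) b lr rt
  fire m a lr rt = machine-step lr rt

  -- T's configuration C is represented with a sentinel blank on the left.
  ⟦_⟧ : Conf → Conf
  ⟦ conf s lr a rt ⟧ = conf (enc (sim s)) (lr ++ △ ∷ []) a rt

  leftOf : MState → List Sym → Sym → List Sym → Conf
  leftOf m [] z rt = conf (enc m) [] △ (z ∷ rt)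
  leftOf m (c ∷ X) z rt = conf (enc m) (X ++ △ ∷ []) c (z ∷ rt)

  move-L : ∀ m X z rt → move L (enc m) z (X ++ △ ∷ []) rt ≡ just (leftOf m X z rt)
  move-L m [] z rt = refl
  move-L m (c ∷ X) z rt = refl

  -- A probe: m₁ steps left and m₂ steps back right, both rewriting what
  -- they read; it succeeds because the head is not on the sentinel.
  probe : ∀ X c rt m₁ m₂ m₃ → (∀ a → Δ m₁ a ≡ just (m₂ , a , L)) → (∀ a → Δ m₂ a ≡ just (m₃ , a , R)) →
    m₁ ∈ states → m₂ ∈ states → Reach (conf (enc m₁) (X ++ △ ∷ []) c rt) (conf (enc m₃) (X ++ △ ∷ []) c rt)
  probe [] c rt m₁ m₂ m₃ left right m₁∈ m₂∈ =
    fire m₁ c (△ ∷ []) rt m₁∈ (left c) ▸ fire m₂ △ [] (c ∷ rt) m₂∈ (right △) ▸ stop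
  probe (e ∷ X) c rt m₁ m₂ m₃ left right m₁∈ m₂∈ =
    fire m₁ c (e ∷ X ++ △ ∷ []) rt m₁∈ (left c) ▸ fire m₂ e (X ++ △ ∷ []) (c ∷ rt) m₂∈ (right e) ▸ stop

  haltProbe : ∀ X c rt → Reach (conf h (X ++ △ ∷ []) c rt) (conf (enc (ctl haltFwd)) (X ++ △ ∷ []) c rt)
  haltProbe X c rt = probe X c rt (ctl halt) (ctl haltBack) (ctl haltFwd) (λ _ → refl) (λ _ → refl) (ctl∈ halt) (ctl∈ haltBack)

  rewind-run : ∀ bs b rt →
    Reach (conf (enc (ctl rewind)) (map ⟨_⟩ bs ++ △ ∷ △ ∷ []) ⟨ b ⟩ rt)
          (conf (enc (sim (q 0))) (△ ∷ []) △ (map ⟨_⟩ bs ʳ++ (⟨ b ⟩ ∷ rt)))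
  rewind-run [] b rt =
    fire (ctl rewind) ⟨ b ⟩ (△ ∷ △ ∷ []) rt (ctl∈ rewind) refl ▸
    fire (ctl rewind) △ (△ ∷ []) (⟨ b ⟩ ∷ rt) (ctl∈ rewind) refl ▸
    fire (ctl launch) △ [] (△ ∷ ⟨ b ⟩ ∷ rt) (ctl∈ launch) refl ▸ stop
  rewind-run (b′ ∷ bs) b rt =
    fire (ctl rewind) ⟨ b ⟩ (⟨ b′ ⟩ ∷ map ⟨_⟩ bs ++ △ ∷ △ ∷ []) rt (ctl∈ rewind) refl ▸
    rewind-run bs b′ (⟨ b ⟩ ∷ rt)

  -- `carry c` holds the bit c taken from the cell to its left; the bits
  -- bs (reversed) are already shifted.
  carry-run : ∀ zs c bs →
    Reach (conf (enc (ctl (carry ⟨ c ⟩))) (map ⟨_⟩ bs ++ △ ∷ △ ∷ []) (scan (map ⟨_⟩ zs)) (drop 1 (map ⟨_⟩ zs)))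
          (conf (enc (sim (q 0))) (△ ∷ []) △ (map ⟨_⟩ bs ʳ++ (⟨ c ⟩ ∷ map ⟨_⟩ zs)))
  carry-run [] c [] =
    fire (ctl (carry ⟨ c ⟩)) △ (△ ∷ △ ∷ []) [] (ctl∈ (carry _)) refl ▸
    fire (ctl rewind) △ (△ ∷ []) (⟨ c ⟩ ∷ []) (ctl∈ rewind) refl ▸
    fire (ctl launch) △ [] (△ ∷ ⟨ c ⟩ ∷ []) (ctl∈ launch) refl ▸ stop
  carry-run [] c (b ∷ bs) =
    fire (ctl (carry ⟨ c ⟩)) △ (⟨ b ⟩ ∷ map ⟨_⟩ bs ++ △ ∷ △ ∷ []) [] (ctl∈ (carry _)) refl ▸
    rewind-run bs b (⟨ c ⟩ ∷ [])
  carry-run (y ∷ zs) c bs =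
    trans (fire (ctl (carry ⟨ c ⟩)) ⟨ y ⟩ (map ⟨_⟩ bs ++ △ ∷ △ ∷ []) (map ⟨_⟩ zs) (ctl∈ (carry _)) refl)
          (move-R _ _ _ (map ⟨_⟩ zs)) ▸
    carry-run zs y (c ∷ bs)

  shift-input : ∀ x → Reach (C₀ x) ⟦ C₀ x ⟧
  shift-input [] =
    fire (ctl start) △ [] [] (ctl∈ start) refl ▸
    fire (ctl (carry △)) △ (△ ∷ []) [] (ctl∈ (carry _)) refl ▸
    fire (ctl launch) △ [] (△ ∷ []) (ctl∈ launch) refl ▸ stop
  shift-input (y ∷ zs) =
    fire (ctl start) △ [] (⟨ y ⟩ ∷ map ⟨_⟩ zs) (ctl∈ start) refl ▸
    trans (fire (ctl (carry △)) ⟨ y ⟩ (△ ∷ []) (map ⟨_⟩ zs) (ctl∈ (carry _)) refl)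
          (move-R _ _ _ (map ⟨_⟩ zs)) ▸
    carry-run zs y []

  simulate-fired : ∀ s lr a rt p b d → instrOf s a ≡ just [ s , a ⇒ p , b , d ] →
    s ∈ Tstates → p ∈ Tstates → ∀ D → move d p b lr rt ≡ just D → Reach⁺ ⟦ conf s lr a rt ⟧ ⟦ D ⟧
  simulate-fired s lr a rt p b R found s∈ p∈ D moved with trans (sym moved) (move-R p b lr rt)
  ... | refl =
    trans (fire (sim s) a (lr ++ △ ∷ []) rt (sim∈ s∈) (cong (simAct s a) found)) (move-R _ _ _ rt) ▸⁺ stop
  simulate-fired s [] a rt p b L found s∈ p∈ D ()
  simulate-fired (q i) (c ∷ lr) a rt p b L found s∈ p∈ .(conf p lr c (b ∷ rt)) refl =
    fire (sim (q i)) a (c ∷ lr ++ △ ∷ []) rt (sim∈ s∈) (cong (simAct (q i) a) found) ▸⁺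
    probe lr c (b ∷ rt) (probeL p) (probeR p) (sim p) (λ _ → refl) (λ _ → refl) (probeL∈ p∈) (probeR∈ p∈)
  simulate-fired h (c ∷ lr) a rt p b L found s∈ p∈ .(conf p lr c (b ∷ rt)) refl =
    fire (sim h) a (c ∷ lr ++ △ ∷ []) rt (sim∈ s∈) (cong (simAct h a) found) ▸⁺
    (haltProbe lr c (a ∷ rt) ⨾
     fire (ctl haltFwd) c (lr ++ △ ∷ []) (a ∷ rt) (ctl∈ haltFwd) refl ▸
     fire (ctl resume) a (c ∷ lr ++ △ ∷ []) rt (ctl∈ resume) (cong (resumeAct a) found) ▸ stop)

  simulate-step : ∀ D D′ → state D ∈ Tstates → step T D ≡ just D′ →
    Reach⁺ ⟦ D ⟧ ⟦ D′ ⟧ × state D′ ∈ Tstates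
  simulate-step (conf s lr a rt) D′ s∈ stepped with instrView s a
  ... | idle none with trans (sym (RT.step-idle lr rt none)) stepped
  ...   | ()
  simulate-step (conf s lr a rt) D′ s∈ stepped | fires p b d ι∈ found =
    simulate-fired s lr a rt p b d found s∈ (target∈ ι∈) D′ moved , moved-state d lr rt moved
    where
      moved : move d p b lr rt ≡ just D′
      moved = trans (sym (RT.step-fires lr rt found)) stepped
      moved-state : ∀ d lr rt → move d p b lr rt ≡ just D′ → state D′ ∈ Tstates
      moved-state R lr [] refl = target∈ ι∈
      moved-state R lr (_ ∷ _) refl = target∈ ι∈
      moved-state L (_ ∷ _) rt refl = target∈ ι∈

  simulate-run : ∀ n C D → state C ∈ Tstates → steps T n C ≡ just D → Reach ⟦ C ⟧ ⟦ D ⟧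
  simulate-run zero C .C s∈ refl = stop
  simulate-run (suc n) C D s∈ run with step T C in stepped
  ... | just C′ with simulate-step C C′ s∈ stepped
  ...   | r , s∈′ = ⁺⇒ r ⨾ simulate-run n C′ D s∈′ run

  sweep-left : ∀ X z rt → instrOf h z ≡ nothing → ∃ λ rt′ → Reach (leftOf (ctl halt) X z rt) (conf h [] △ rt′)
  sweep-left [] z rt none = z ∷ rt , stop
  sweep-left (c ∷ X) z rt none with sweep-left X quiet (z ∷ rt) (quiet-idle z none)
  ... | rt′ , r = rt′ ,
    (haltProbe X c (z ∷ rt) ⨾
     fire (ctl haltFwd) c (X ++ △ ∷ []) (z ∷ rt) (ctl∈ haltFwd) refl ▸
     fire (ctl resume) z (c ∷ X ++ △ ∷ []) rt (ctl∈ resume) (cong (resumeAct z) none) ▸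
     trans (fire (ctl sweep) c (X ++ △ ∷ []) (z ∷ rt) (ctl∈ sweep) refl) (move-L (ctl halt) X quiet (z ∷ rt)) ▸ r)

  simulate-halt : ∀ lr a rt → step T (conf h lr a rt) ≡ nothing →
    ∃ λ rt′ → Reach ⟦ conf h lr a rt ⟧ (conf h [] △ rt′)
  simulate-halt lr a rt halted with instrView h a
  ... | idle none with sweep-left lr a rt none
  ...   | rt′ , r = rt′ ,
    (trans (fire (sim h) a (lr ++ △ ∷ []) rt (sim∈ (here refl)) (cong (simAct h a) none)) (move-L (ctl halt) lr a rt) ▸ r)
  simulate-halt lr a rt halted | fires p b d ι∈ found with RT.step-fires lr rt found
  simulate-halt [] a rt halted | fires p b L ι∈ found | _ =
    a ∷ rt , (fire (sim h) a (△ ∷ []) rt (sim∈ (here refl)) (cong (simAct h a) found) ▸ stop)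
  simulate-halt (_ ∷ _) a rt halted | fires p b L ι∈ found | fired with trans (sym fired) halted
  ... | ()
  simulate-halt lr a [] halted | fires p b R ι∈ found | fired with trans (sym fired) halted
  ... | ()
  simulate-halt lr a (_ ∷ _) halted | fires p b R ι∈ found | fired with trans (sym fired) halted
  ... | ()

  DeadEnd : Conf → Set
  DeadEnd C = step simulator C ≡ nothing × ∃ λ j → state C ≡ q j

  simulate-stuck : ∀ i lr a rt → q i ∈ Tstates → step T (conf (q i) lr a rt) ≡ nothing →
    ∃ λ C′ → Reach ⟦ conf (q i) lr a rt ⟧ C′ × DeadEnd C′
  simulate-stuck i lr a rt s∈ stuck with instrView (q i) a
  ... | idle none =
    ⟦ conf (q i) lr a rt ⟧ , stop , machine-stuck {sim (q i)} (lr ++ △ ∷ []) rt (cong (simAct (q i) a) none) , _ , refl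
  ... | fires p b d ι∈ found with RT.step-fires lr rt found
  simulate-stuck i [] a rt s∈ stuck | fires p b L ι∈ found | _ =
    conf (enc (probeL p)) [] △ (b ∷ rt) ,
    (fire (sim (q i)) a (△ ∷ []) rt (sim∈ s∈) (cong (simAct (q i) a) found) ▸ stop) ,
    fire (probeL p) △ [] (b ∷ rt) (probeL∈ (target∈ ι∈)) refl , _ , refl
  simulate-stuck i (_ ∷ _) a rt s∈ stuck | fires p b L ι∈ found | fired with trans (sym fired) stuck
  ... | ()
  simulate-stuck i lr a [] s∈ stuck | fires p b R ι∈ found | fired with trans (sym fired) stuck
  ... | ()
  simulate-stuck i lr a (_ ∷ _) s∈ stuck | fires p b R ι∈ found | fired with trans (sym fired) stuck
  ... | ()

  HaltsFrom : Conf → Set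
  HaltsFrom C = ∃₂ λ n D → steps T n C ≡ just D × state D ≡ h × step T D ≡ nothing

  data Progress (i : ℕ) (C : Conf) : Set where
    running : ∀ k C′ → i ≤ k → steps simulator k ⟦ C ⟧ ≡ just C′ → Progress i C
    halted  : HaltsFrom C → Progress i C
    dead    : ∀ C′ → Reach ⟦ C ⟧ C′ → DeadEnd C′ → Progress i C

  progress : ∀ i C → state C ∈ Tstates → Progress i C
  progress zero C s∈ = running 0 ⟦ C ⟧ z≤n refl
  progress (suc i) C s∈ with step T C in stepped
  progress (suc i) C s∈ | just C′ with simulate-step C C′ s∈ stepped
  ... | (k₁ , r₁) , s∈′ with progress i C′ s∈′
  ...   | running k C″ i≤k r = running (suc (k₁ + k)) C″ (s≤s (≤-trans i≤k (m≤n+m k k₁))) (proj₂ (⁺⇒ (k₁ , r₁) ⨾ (k , r)))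
  ...   | halted (n , D , run , in-h , stuck) = halted (suc n , D , RT.steps-suc n stepped run , in-h , stuck)
  ...   | dead C″ r end = dead C″ (⁺⇒ (k₁ , r₁) ⨾ r) end
  progress (suc i) (conf h lr a rt) s∈ | nothing = halted (0 , conf h lr a rt , refl , refl , stepped)
  progress (suc i) (conf (q j) lr a rt) s∈ | nothing with simulate-stuck j lr a rt s∈ stepped
  ... | C′ , r , end = dead C′ r end

  accepting-terminal : ∀ rt → Terminal simulator (conf h [] △ rt)
  accepting-terminal rt =
    inj₂ (_ , machine-υ [] rt (ctl∈ halt) refl , TBOX-applicable h [] △ rt (enc (ctl haltBack)) △ L)

  q0∈ : q 0 ∈ Tstates
  q0∈ = there (here refl)

  complete : ∀ {A x} → HaltsH T x → Accepts A simulator x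
  complete {x = x} (n , conf .h lr a rt , run , refl , stuck) with simulate-halt lr a rt stuck
  ... | rt′ , swept with shift-input x ⨾ simulate-run n (C₀ x) _ q0∈ run ⨾ swept
  ...   | k , r = k , conf h [] △ rt′ , r , refl , accepting-terminal rt′

  -- The simulator cannot run longer than its accepting
  -- run, and a dead end would have to be the accepting configuration.
  sound : ∀ {A x} → Accepts A simulator x → HaltsH T x
  sound {A} {x} (n , C , run , accepted , term) with shift-input x | progress (suc n) (C₀ x) q0∈
  ... | k₀ , r₀ | running k C′ n<k r =
    ⊥-elim (<⇒≱ (≤-trans n<k (m≤n+m k k₀)) (halted-bound n (k₀ + k) run (Terminal⇒stuck term) (steps-+ k₀ k r₀ r)))
  ... | _ | halted halts = halts
  ... | r₀ | dead C′ r (stuck , j , in-q) =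
    ⊥-elim (SBOX-rejects-q A C j (trans (cong state C≡C′) in-q) accepted)
    where
      C≡C′ : C ≡ C′
      C≡C′ = halted-unique n (proj₁ (r₀ ⨾ r)) run (Terminal⇒stuck term) (proj₂ (r₀ ⨾ r)) stuck

open Simulator using (simulator; simulator-syntaxProc; sound; complete)

mainTheorem5 : (Lang : List Bit → Set) → RE Lang →
    Σ (List Inst) λ M → SyntaxProc M ×
    (∀ (hs : List (List Bit)) (x : List Bit) →
    (Accepts (stateAfter hs) M x → Lang x) × (Lang x → Accepts (stateAfter hs) M x))
mainTheorem5 Lang (T , _ , semidecides , halts⇒Lang) =
  simulator T , simulator-syntaxProc T ,
  λ hs x → (λ accepted → halts⇒Lang x (sound T accepted)) , (λ x∈L → complete T (semidecides x x∈L))
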